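{- For every $n \ge 0$, the set $A_{\mathbb{Z}[i],n}$ is closed under complex conjugation.
   Context: $A_{\mathbb{Z}[i],0} = \{0,\pm 1,\pm i\}$, and for $n\ge 1$, $A_{\mathbb{Z}[i],n} = A_{\mathbb{Z}[i],n-1} \cup \{\beta \in \mathbb{Z}[i] : \text{every residue class of } \mathbb{Z}[i]/(\beta) \text{ has a representative in } A_{\mathbb{Z}[i],n-1}\}$. -}

module Defs where

open import Data.Nat using (ℕ; zero; suc)
open import Data.Integer using (ℤ; +_; -_; _+_; _-_; _*_)
open import Data.Product using (_×_; _,_; Σ; ∃)
open import Data.Sum using (_⊎_)
open import Relation.Binary.PropositionalEquality using (_≡_)

record ℤ[i] : Set where
  constructor _+_i
  field
    re : ℤ
    im : ℤ
open ℤ[i] public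

infixl 6 _-ᵍ_
infixl 7 _*ᵍ_

_-ᵍ_ : ℤ[i] → ℤ[i] → ℤ[i]
(a + b i) -ᵍ (c + d i) = (a - c) + (b - d) i

_*ᵍ_ : ℤ[i] → ℤ[i] → ℤ[i]
(a + b i) *ᵍ (c + d i) = (a * c - b * d) + (a * d + b * c) i

conj : ℤ[i] → ℤ[i]
conj (a + b i) = a + (- b) i

_∣ᵍ_ : ℤ[i] → ℤ[i] → Set
β ∣ᵍ α = Σ ℤ[i] λ κ → α ≡ κ *ᵍ β

_≡_[mod_] : ℤ[i] → ℤ[i] → ℤ[i] → Set
α ≡ γ [mod β ] = β ∣ᵍ (α -ᵍ γ)

data InA₀ : ℤ[i] → Set where
  zeroA : InA₀ ((+ 0) + (+ 0) i)
  one   : InA₀ ((+ 1) + (+ 0) i)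
  -one  : InA₀ ((- (+ 1)) + (+ 0) i)
  unitI : InA₀ ((+ 0) + (+ 1) i)
  -unitI : InA₀ ((+ 0) + (- (+ 1)) i)

InA : ℕ → ℤ[i] → Set
InA zero    α = InA₀ α
InA (suc n) β = InA n β ⊎ ((γ : ℤ[i]) → Σ ℤ[i] λ δ → InA n δ × γ ≡ δ [mod β ])

{-# OPTIONS --safe #-}
-- Conjugation is an involutive ring automorphism of ℤ[i], so it carries congruences
-- modulo β to congruences modulo conj β. Hence if a conjugation-closed set contains
-- representatives of all classes mod β, it does so mod conj β as well; since A₀ is
-- closed under conjugation, induction on n closes every Aₙ.
module Submission where

open import Defs
open import Data.Nat using (ℕ; zero; suc)
open import Data.Integer using (-_; _+_; _-_; _*_)
open import Data.Integer.Properties using (neg-involutive; neg-distrib-+)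
open import Data.Integer.Tactic.RingSolver using (solve-∀)
open import Data.Product using (_×_; _,_; Σ)
open import Data.Sum using (map)
open import Relation.Binary.PropositionalEquality using (_≡_; cong; cong₂; trans; subst)

conj-involutive : ∀ α → conj (conj α) ≡ α
conj-involutive (a + b i) = cong (a +_i) (neg-involutive b)

conj-distrib--ᵍ : ∀ α β → conj (α -ᵍ β) ≡ conj α -ᵍ conj β
conj-distrib--ᵍ (a + b i) (c + d i) = cong ((a - c) +_i) (neg-distrib-+ b (- d))

conj-distrib-*ᵍ : ∀ α β → conj (α *ᵍ β) ≡ conj α *ᵍ conj β
conj-distrib-*ᵍ (a + b i) (c + d i) = cong₂ _+_i (re-eq a b c d) (im-eq a b c d)
  where
  re-eq : ∀ a b c d → a * c - b * d ≡ a * c - (- b) * (- d)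
  re-eq = solve-∀
  im-eq : ∀ a b c d → - (a * d + b * c) ≡ a * (- d) + (- b) * c
  im-eq = solve-∀

conj-preserves-∣ᵍ : ∀ {β α} → β ∣ᵍ α → conj β ∣ᵍ conj α
conj-preserves-∣ᵍ {β} (κ , α≡κβ) = conj κ , trans (cong conj α≡κβ) (conj-distrib-*ᵍ κ β)

conj-preserves-≡-mod : ∀ {α γ β} → α ≡ γ [mod β ] → conj α ≡ conj γ [mod conj β ]
conj-preserves-≡-mod {α} {γ} β∣α-γ =
  subst (conj _ ∣ᵍ_) (conj-distrib--ᵍ α γ) (conj-preserves-∣ᵍ β∣α-γ)

ConjClosed : (ℤ[i] → Set) → Set
ConjClosed S = ∀ α → S α → S (conj α)

RepresentsResidues : (ℤ[i] → Set) → ℤ[i] → Set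
RepresentsResidues S β = (γ : ℤ[i]) → Σ ℤ[i] λ δ → S δ × γ ≡ δ [mod β ]

conj-preserves-RepresentsResidues : ∀ {S β} → ConjClosed S →
  RepresentsResidues S β → RepresentsResidues S (conj β)
conj-preserves-RepresentsResidues closed reps γ with reps (conj γ)
... | δ , δ∈S , γ̄≡δ = conj δ , closed δ δ∈S ,
  subst (_≡ conj δ [mod conj _ ]) (conj-involutive γ) (conj-preserves-≡-mod {conj γ} {δ} γ̄≡δ)

InA₀-conjClosed : ConjClosed InA₀
InA₀-conjClosed _ zeroA  = zeroA
InA₀-conjClosed _ one    = one
InA₀-conjClosed _ -one   = -one
InA₀-conjClosed _ unitI  = -unitI
InA₀-conjClosed _ -unitI = unitI

mainTheorem6 : (n : ℕ) (α : ℤ[i]) → InA n α → InA n (conj α)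
mainTheorem6 zero    = InA₀-conjClosed
mainTheorem6 (suc n) α =
  map (mainTheorem6 n α) (conj-preserves-RepresentsResidues (mainTheorem6 n))
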